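{- Let $k\ge2$ and $n$ be positive integers with $k\le n\le k^5-1$, and let $\vec{B}\in\mathbb{F}_2^{k\times n}$ be a proper basis such that for every $i<k$, \[d_{\min}(\mathcal{C}(\vec{B}_{[i,k]}))\ge\frac{n'-k'}{10\log k'},\] where $n':=|\mathsf{Supp}(\vec{B}_{[i,k]})|$ and $k':=k-i+1$. Then $\vec{B}$ has at most $20\log(k)\log(n-k)+1\le O(\log^2n)$ epipodal vectors $\vec{b}_i^+$ of Hamming weight at least two.
   Context: $\log$ is base 2. $\mathcal{C}(\vec{M})$ is the row span; $\mathsf{Supp}$ of a code or matrix is the union of supports of its vectors; $d_{\min}$ is minimum nonzero Hamming weight. $\pi^\perp_{\{\vec{x}_1,\dots,\vec{x}_m\}}$ zeroes coordinates in the union of supports; $\pi_i:=\pi^\perp_{\{\vec{b}_1,\dots,\vec{b}_{i-1}\}}$, epipodal vectors $\vec{b}_i^+:=\pi_i(\vec{b}_i)$, $\vec{B}_{[i,j]}:=(\pi_i(\vec{b}_i);\dots;\pi_i(\vec{b}_j))$. Proper: all $\vec{b}_i^+\ne\vec0$. -}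

module Defs where

open import Data.Nat using (ℕ; zero; suc; _+_; _≤ᵇ_)
open import Data.Bool using (Bool; true; false; _∧_; _∨_; _xor_; if_then_else_; not)
open import Data.Fin using (Fin; zero; suc; toℕ)
open import Function using (_∘_)
open import Relation.Binary.PropositionalEquality using (_≡_)
open import Relation.Nullary using (¬_)

-- Vectors in F₂ⁿ are functions Fin n → Bool (true = 1, xor = addition).
-- A k × n matrix over F₂ is a function Fin k → Fin n → Bool (row-major).
F2Vec : ℕ → Set
F2Vec n = Fin n → Bool

F2Mat : ℕ → ℕ → Set
F2Mat k n = Fin k → Fin n → Bool

wt : ∀ {n} → F2Vec n → ℕ
wt {zero}  v = 0
wt {suc n} v = (if v zero then 1 else 0) + wt (v ∘ suc)

anyFin : ∀ {k} → (Fin k → Bool) → Bool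
anyFin {zero}  f = false
anyFin {suc k} f = f zero ∨ anyFin (f ∘ suc)

xorFin : ∀ {k} → (Fin k → Bool) → Bool
xorFin {zero}  f = false
xorFin {suc k} f = f zero xor xorFin (f ∘ suc)

lincomb : ∀ {k n} → F2Vec k → F2Mat k n → F2Vec n
lincomb a M c = xorFin (λ j → a j ∧ M j c)

IsZero : ∀ {n} → F2Vec n → Set
IsZero v = ∀ c → v c ≡ false

LinIndep : ∀ {k n} → F2Mat k n → Set
LinIndep M = ∀ a → IsZero (lincomb a M) → ∀ j → a j ≡ false

-- Indices are 0-based: row i (Fin k) is the paper's b_{i+1}.
-- Coordinate c lies in the union of supports of rows b_j, j < i.
inPrefixSupp : ∀ {k n} → F2Mat k n → Fin k → Fin n → Bool
inPrefixSupp B i c = anyFin (λ j → (suc (toℕ j) ≤ᵇ toℕ i) ∧ B j c)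

proj : ∀ {k n} → F2Mat k n → Fin k → F2Vec n → F2Vec n
proj B i v c = if inPrefixSupp B i c then false else v c

epi : ∀ {k n} → F2Mat k n → Fin k → F2Vec n
epi B i = proj B i (B i)

Proper : ∀ {k n} → F2Mat k n → Set
Proper B = ∀ i → ¬ IsZero (epi B i)

-- B_[i,k] : rows π_i(b_j) for j ≥ i (rows j < i replaced by 0, which
-- does not change the row span or the support).
block : ∀ {k n} → F2Mat k n → Fin k → F2Mat k n
block B i j = if toℕ i ≤ᵇ toℕ j then proj B i (B j) else (λ _ → false)

supp : ∀ {k n} → F2Mat k n → F2Vec n
supp M c = anyFin (λ j → M j c)

numHeavyEpi : ∀ {k n} → F2Mat k n → ℕ
numHeavyEpi B = wt (λ i → 2 ≤ᵇ wt (epi B i))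

-- Write d_j = wt b_j⁺ − 1 and T_i = Σ_{j ≥ i} d_j. The epipodal vectors have pairwise disjoint
-- supports, and b_j⁺ lies in Supp(B_[i,k]) for j ≥ i, so n' − k' ≥ T_i. Applied to the codeword
-- b_i⁺ of B_[i,k], the distance hypothesis gives T_i ≤ 10 log k · wt b_i⁺ ≤ 20 log k · d_i at
-- every heavy index i. Thus T shrinks by the factor 1 − 1/(20 log k) at each heavy index; with
-- h heavy indices, n − k ≥ T_0 ≥ (1 − 1/(20 log k))^-(h−1), whence h − 1 ≤ 20 log k log(n − k).
-- The logarithms are replaced by the rational bounds p/q and u/v and the estimate is carried
-- out on integer powers, (1 + y)^(1/y + 1) ≥ 2 standing in for log(1 + y) ≥ y / (1 + y).
module Submission where

open import Defs
open import Data.Nat using (ℕ; zero; suc; _+_; _*_; _∸_; _^_; _≤_; _<_; z≤n; s≤s; _≤ᵇ_; _≤?_)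
open import Data.Nat.Properties
open import Data.Nat.Tactic.RingSolver using (solve-∀)
open import Algebra.Properties.CommutativeSemigroup *-commutativeSemigroup using (interchange)
open import Algebra.Properties.CommutativeMonoid.Sum +-0-commutativeMonoid using (sum; sum-cong-≗; ∑-comm)
open import Data.Bool using (Bool; true; false; if_then_else_; _∧_)
open import Data.Bool.Properties using (T-≡; xor-identityʳ)
open import Data.Fin using (Fin; zero; suc; toℕ)
open import Data.Fin.Properties as Fin using (toℕ-injective)
open import Data.Product using (Σ; _,_; _×_; proj₁; proj₂)
open import Function using (_∘_; Equivalence)
open import Relation.Binary.Definitions using (tri<; tri≈; tri>)
open import Relation.Binary.PropositionalEquality
open import Relation.Nullary using (¬_; yes; no; contradiction)

^-distribʳ-* : ∀ m n o → (m * n) ^ o ≡ m ^ o * n ^ o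
^-distribʳ-* m n zero = refl
^-distribʳ-* m n (suc o) = begin
  m * n * (m * n) ^ o      ≡⟨ cong (m * n *_) (^-distribʳ-* m n o) ⟩
  m * n * (m ^ o * n ^ o)  ≡⟨ interchange m n (m ^ o) (n ^ o) ⟩
  m * m ^ o * (n * n ^ o)  ∎
  where open ≡-Reasoning

^-*-comm : ∀ a m t v → (a ^ m) ^ (t * v) ≡ ((a ^ t) ^ v) ^ m
^-*-comm a m t v = begin
  (a ^ m) ^ (t * v)    ≡⟨ ^-*-assoc a m (t * v) ⟩
  a ^ (m * (t * v))    ≡⟨ cong (a ^_) (reorder m t v) ⟩
  a ^ (t * v * m)      ≡⟨ ^-*-assoc a (t * v) m ⟨
  (a ^ (t * v)) ^ m    ≡⟨ cong (_^ m) (^-*-assoc a t v) ⟨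
  ((a ^ t) ^ v) ^ m    ∎
  where
  open ≡-Reasoning
  reorder : ∀ m t v → m * (t * v) ≡ t * v * m
  reorder = solve-∀

^-cancelʳ-≤ : ∀ m {a b} → 1 < m → m ^ a ≤ m ^ b → a ≤ b
^-cancelʳ-≤ m {a} {b} 1<m le with a ≤? b
... | yes a≤b = a≤b
... | no a≰b = contradiction le (<⇒≱ (^-monoʳ-< m 1<m (≰⇒> a≰b)))

^-cancelʳ-< : ∀ m {a b} → 1 < m → m ^ a < m ^ b → a < b
^-cancelʳ-< (suc m) {a} {b} 1<m lt with b ≤? a
... | yes b≤a = contradiction lt (≤⇒≯ (^-monoʳ-≤ (suc m) b≤a))
... | no b≰a = ≰⇒> b≰a

^-log-compare : ∀ k S m p q → 2 ^ S ≤ k ^ m → k ^ q ≤ 2 ^ p → S * q ≤ p * m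
^-log-compare k S m p q 2ˢ≤kᵐ kᵠ≤2ᵖ = ^-cancelʳ-≤ 2 (s≤s (s≤s z≤n)) (begin
  2 ^ (S * q)      ≡⟨ ^-*-assoc 2 S q ⟨
  (2 ^ S) ^ q      ≤⟨ ^-monoˡ-≤ q 2ˢ≤kᵐ ⟩
  (k ^ m) ^ q      ≡⟨ ^-*-assoc k m q ⟩
  k ^ (m * q)      ≡⟨ cong (k ^_) (*-comm m q) ⟩
  k ^ (q * m)      ≡⟨ ^-*-assoc k q m ⟨
  (k ^ q) ^ m      ≤⟨ ^-monoˡ-≤ m kᵠ≤2ᵖ ⟩
  (2 ^ p) ^ m      ≡⟨ ^-*-assoc 2 p m ⟩
  2 ^ (p * m)      ∎)
  where open ≤-Reasoning

bernoulli : ∀ N r → N ^ suc r + suc r * N ^ r ≤ suc N ^ suc r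
bernoulli N zero = ≤-reflexive (+-comm (N * 1) 1)
bernoulli N (suc r) = begin
  N * (N * N ^ r) + suc (suc r) * (N * N ^ r)  ≤⟨ m≤m+n _ (suc r * N ^ r) ⟩
  N * (N * N ^ r) + suc (suc r) * (N * N ^ r) + suc r * N ^ r
    ≡⟨ expand N r (N ^ r) ⟩
  suc N * (N * N ^ r + suc r * N ^ r)          ≤⟨ *-monoʳ-≤ (suc N) (bernoulli N r) ⟩
  suc N ^ suc (suc r)                          ∎
  where
  open ≤-Reasoning
  expand : ∀ N r a → N * (N * a) + suc (suc r) * (N * a) + suc r * a ≡ suc N * (N * a + suc r * a)
  expand = solve-∀

-- With M = x + q this says q / M ≤ log (M / x).
2^q*x^[x+q]≤[x+q]^[x+q] : ∀ q x → 2 ^ q * x ^ (x + q) ≤ (x + q) ^ (x + q)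
2^q*x^[x+q]≤[x+q]^[x+q] zero x rewrite +-identityʳ x = ≤-reflexive (+-identityʳ _)
2^q*x^[x+q]≤[x+q]^[x+q] (suc q) x rewrite +-suc x q = begin
  2 ^ suc q * x ^ suc N        ≡⟨ regroup (2 ^ q) x (x ^ N) ⟩
  2 * x * (2 ^ q * x ^ N)      ≤⟨ *-monoʳ-≤ (2 * x) (2^q*x^[x+q]≤[x+q]^[x+q] q x) ⟩
  2 * x * N ^ N                ≤⟨ *-monoˡ-≤ (N ^ N) (*-monoʳ-≤ 2 (m≤m+n x q)) ⟩
  2 * N * N ^ N                ≡⟨ double N (N ^ N) ⟩
  N ^ suc N + N * N ^ N        ≤⟨ +-monoʳ-≤ (N ^ suc N) (*-monoˡ-≤ (N ^ N) (n≤1+n N)) ⟩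
  N ^ suc N + suc N * N ^ N    ≤⟨ bernoulli N N ⟩
  suc N ^ suc N                ∎
  where
  open ≤-Reasoning
  N = x + q
  regroup : ∀ a x b → 2 * a * (x * b) ≡ 2 * x * (a * b)
  regroup = solve-∀
  double : ∀ N b → 2 * N * b ≡ N * b + N * b
  double = solve-∀

-- In logarithms: q / M ≤ log (M / x), t · log (M / x) ≤ log A and v · log A ≤ u.
log-ratio-bound : ∀ x M A t q u v → 1 ≤ x →
  2 ^ q * x ^ M ≤ M ^ M → M ^ t ≤ A * x ^ t → A ^ v ≤ 2 ^ u → t * q * v ≤ M * u
log-ratio-bound (suc x') M A t q u v _ growth bound size =
  subst₂ _≤_ (reorder q t v) (*-comm u M) (^-cancelʳ-≤ 2 (s≤s (s≤s z≤n)) powers)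
  where
  x = suc x'
  X = ((x ^ t) ^ v) ^ M
  open ≤-Reasoning
  raised : (2 ^ q) ^ (t * v) * X ≤ (2 ^ u) ^ M * X
  raised = begin
    (2 ^ q) ^ (t * v) * X                  ≡⟨ cong ((2 ^ q) ^ (t * v) *_) (^-*-comm x M t v) ⟨
    (2 ^ q) ^ (t * v) * (x ^ M) ^ (t * v)  ≡⟨ ^-distribʳ-* (2 ^ q) (x ^ M) (t * v) ⟨
    (2 ^ q * x ^ M) ^ (t * v)              ≤⟨ ^-monoˡ-≤ (t * v) growth ⟩
    (M ^ M) ^ (t * v)                      ≡⟨ ^-*-comm M M t v ⟩
    ((M ^ t) ^ v) ^ M                      ≤⟨ ^-monoˡ-≤ M (^-monoˡ-≤ v bound) ⟩
    ((A * x ^ t) ^ v) ^ M                  ≡⟨ cong (_^ M) (^-distribʳ-* A (x ^ t) v) ⟩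
    (A ^ v * (x ^ t) ^ v) ^ M              ≡⟨ ^-distribʳ-* (A ^ v) ((x ^ t) ^ v) M ⟩
    (A ^ v) ^ M * X                        ≤⟨ *-monoˡ-≤ X (^-monoˡ-≤ M size) ⟩
    (2 ^ u) ^ M * X                        ∎
  powers : 2 ^ (q * (t * v)) ≤ 2 ^ (u * M)
  powers = subst₂ _≤_ (^-*-assoc 2 q (t * v)) (^-*-assoc 2 u M)
    (*-cancelʳ-≤ _ _ X {{m^n≢0 _ M {{m^n≢0 _ v {{m^n≢0 x t}}}}}} raised)
  reorder : ∀ q t v → q * (t * v) ≡ t * q * v
  reorder = solve-∀

10w≤20[w∸1] : ∀ p w → 1 ≤ w ∸ 1 → p * (10 * w) ≤ 20 * p * (w ∸ 1)
10w≤20[w∸1] p (suc (suc d)) _ = begin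
  p * (10 * suc (suc d))               ≤⟨ m≤m+n _ (10 * p * d) ⟩
  p * (10 * suc (suc d)) + 10 * p * d  ≡⟨ regroup p d ⟩
  20 * p * suc d                       ∎
  where
  open ≤-Reasoning
  regroup : ∀ p d → p * (10 * suc (suc d)) + 10 * p * d ≡ 20 * p * suc d
  regroup = solve-∀

suc-≤ᵇ-suc : ∀ m n → (suc m ≤ᵇ suc n) ≡ (m ≤ᵇ n)
suc-≤ᵇ-suc zero n = refl
suc-≤ᵇ-suc (suc m) n = refl

2≤ᵇ≡1≤ᵇ∸1 : ∀ w → (2 ≤ᵇ w) ≡ (1 ≤ᵇ w ∸ 1)
2≤ᵇ≡1≤ᵇ∸1 zero = refl
2≤ᵇ≡1≤ᵇ∸1 (suc w) = refl

≤⇒≤ᵇ≡true : ∀ {m n} → m ≤ n → (m ≤ᵇ n) ≡ true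
≤⇒≤ᵇ≡true = Equivalence.to T-≡ ∘ ≤⇒≤ᵇ

≤ᵇ≡true⇒≤ : ∀ {m n} → (m ≤ᵇ n) ≡ true → m ≤ n
≤ᵇ≡true⇒≤ {m} {n} = ≤ᵇ⇒≤ m n ∘ Equivalence.from T-≡

sum-mono-≤ : ∀ {k} {f g : Fin k → ℕ} → (∀ j → f j ≤ g j) → sum f ≤ sum g
sum-mono-≤ {zero} _ = z≤n
sum-mono-≤ {suc k} f≤g = +-mono-≤ (f≤g zero) (sum-mono-≤ (f≤g ∘ suc))

sum-∸1 : ∀ {k} (f : Fin k → ℕ) → (∀ j → 1 ≤ f j) → sum f ≡ sum (λ j → f j ∸ 1) + k
sum-∸1 {zero} f _ = refl
sum-∸1 {suc k} f pos with f zero | pos zero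
... | suc a | _ = begin
  suc a + sum (f ∘ suc)                       ≡⟨ cong (suc a +_) (sum-∸1 (f ∘ suc) (pos ∘ suc)) ⟩
  suc a + (sum (λ j → f (suc j) ∸ 1) + k)     ≡⟨ shuffle a (sum (λ j → f (suc j) ∸ 1)) k ⟩
  a + sum (λ j → f (suc j) ∸ 1) + suc k       ∎
  where
  open ≡-Reasoning
  shuffle : ∀ a s k → suc a + (s + k) ≡ a + s + suc k
  shuffle = solve-∀

tailSum : ∀ {k} → (Fin k → ℕ) → Fin k → ℕ
tailSum f zero = sum f
tailSum f (suc i) = tailSum (f ∘ suc) i

tailSum≡sum-if-≤ : ∀ {k} (f : Fin k → ℕ) i →
  tailSum f i ≡ sum (λ j → if toℕ i ≤ᵇ toℕ j then f j else 0)
tailSum≡sum-if-≤ f zero = refl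
tailSum≡sum-if-≤ f (suc i) = trans (tailSum≡sum-if-≤ (f ∘ suc) i)
  (sum-cong-≗ (λ j → cong (if_then f (suc j) else 0) (sym (suc-≤ᵇ-suc (toℕ i) (toℕ j)))))

tailSum-∸1 : ∀ {k} (f : Fin k → ℕ) → (∀ j → 1 ≤ f j) →
  ∀ i → tailSum f i ≡ tailSum (λ j → f j ∸ 1) i + (k ∸ toℕ i)
tailSum-∸1 f pos zero = sum-∸1 f pos
tailSum-∸1 f pos (suc i) = tailSum-∸1 (f ∘ suc) (pos ∘ suc) i

∧-true : ∀ {a b} → a ∧ b ≡ true → a ≡ true × b ≡ true
∧-true {true} {true} _ = refl , refl

anyFin-intro : ∀ {k} (f : Fin k → Bool) j → f j ≡ true → anyFin f ≡ true
anyFin-intro f zero fⱼ rewrite fⱼ = refl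
anyFin-intro f (suc j) fⱼ with f zero
... | true = refl
... | false = anyFin-intro (f ∘ suc) j fⱼ

anyFin-elim : ∀ {k} (f : Fin k → Bool) → anyFin f ≡ true → Σ (Fin k) (λ j → f j ≡ true)
anyFin-elim {suc k} f any with f zero in f₀
... | true = zero , f₀
... | false with j , fⱼ ← anyFin-elim (f ∘ suc) any = suc j , fⱼ

bit : Bool → ℕ
bit b = if b then 1 else 0

wt≡sum-bit : ∀ {n} (v : F2Vec n) → wt v ≡ sum (bit ∘ v)
wt≡sum-bit {zero} v = refl
wt≡sum-bit {suc n} v = cong (bit (v zero) +_) (wt≡sum-bit (v ∘ suc))

wt-cong : ∀ {n} {u v : F2Vec n} → (∀ c → u c ≡ v c) → wt u ≡ wt v
wt-cong {zero} _ = refl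
wt-cong {suc n} u≗v = cong₂ _+_ (cong bit (u≗v zero)) (wt-cong (u≗v ∘ suc))

wt≤length : ∀ {n} (v : F2Vec n) → wt v ≤ n
wt≤length {zero} v = z≤n
wt≤length {suc n} v with v zero
... | true = s≤s (wt≤length (v ∘ suc))
... | false = m≤n⇒m≤1+n (wt≤length (v ∘ suc))

wt-IsZero : ∀ {n} (v : F2Vec n) → IsZero v → wt v ≡ 0
wt-IsZero {zero} v _ = refl
wt-IsZero {suc n} v v≡0 rewrite v≡0 zero = wt-IsZero (v ∘ suc) (v≡0 ∘ suc)

wt≡0⇒IsZero : ∀ {n} (v : F2Vec n) → wt v ≡ 0 → IsZero v
wt≡0⇒IsZero {suc n} v wt≡0 c with v zero in v₀
wt≡0⇒IsZero {suc n} v () c | true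
wt≡0⇒IsZero {suc n} v wt≡0 zero | false = v₀
wt≡0⇒IsZero {suc n} v wt≡0 (suc c) | false = wt≡0⇒IsZero (v ∘ suc) wt≡0 c

wt-∧ : ∀ {n} b (v : F2Vec n) → wt (λ c → b ∧ v c) ≡ (if b then wt v else 0)
wt-∧ true v = refl
wt-∧ {n} false v = wt-IsZero {n} _ (λ _ → refl)

true-unique-wt≤bit : ∀ {k} (g : Fin k → Bool) (b : Bool) →
  (∀ j → g j ≡ true → b ≡ true) → (∀ j j' → g j ≡ true → g j' ≡ true → j ≡ j') →
  wt g ≤ bit b
true-unique-wt≤bit {zero} g b _ _ = z≤n
true-unique-wt≤bit {suc k} g b g⇒b unique with g zero in g₀
... | true rewrite g⇒b zero g₀ = ≤-reflexive (cong suc (wt-IsZero (g ∘ suc) tail-false))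
  where
  tail-false : IsZero (g ∘ suc)
  tail-false j with g (suc j) in gⱼ
  ... | true with () ← unique zero (suc j) g₀ gⱼ
  ... | false = refl
... | false = true-unique-wt≤bit (g ∘ suc) b (g⇒b ∘ suc)
  (λ j j' p p' → Fin.suc-injective (unique (suc j) (suc j') p p'))

disjoint-wt-sum≤wt : ∀ {k n} (M : Fin k → F2Vec n) (V : F2Vec n) →
  (∀ c j j' → M j c ≡ true → M j' c ≡ true → j ≡ j') → (∀ j c → M j c ≡ true → V c ≡ true) →
  sum (λ j → wt (M j)) ≤ wt V
disjoint-wt-sum≤wt M V disjoint M⊆V = begin
  sum (λ j → wt (M j))                     ≡⟨ sum-cong-≗ (λ j → wt≡sum-bit (M j)) ⟩
  sum (λ j → sum (λ c → bit (M j c)))      ≡⟨ ∑-comm (λ j c → bit (M j c)) ⟩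
  sum (λ c → sum (λ j → bit (M j c)))      ≡⟨ sum-cong-≗ (λ c → wt≡sum-bit (λ j → M j c)) ⟨
  sum (λ c → wt (λ j → M j c))             ≤⟨ sum-mono-≤ column≤1 ⟩
  sum (bit ∘ V)                            ≡⟨ wt≡sum-bit V ⟨
  wt V                                     ∎
  where
  open ≤-Reasoning
  column≤1 : ∀ c → wt (λ j → M j c) ≤ bit (V c)
  column≤1 c = true-unique-wt≤bit (λ j → M j c) (V c) (λ j → M⊆V j c) (disjoint c)

geometric-step : ∀ q x d R t → q * (d + R) ≤ (q + x) * d → (q + x) ^ t ≤ R * x ^ t →
  (q + x) ^ suc t ≤ (d + R) * x ^ suc t
geometric-step q x d R t head tail = begin
  (q + x) * (q + x) ^ t          ≤⟨ *-monoʳ-≤ (q + x) tail ⟩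
  (q + x) * (R * x ^ t)          ≡⟨ expand q x R (x ^ t) ⟩
  (q * R + x * R) * x ^ t        ≤⟨ *-monoˡ-≤ (x ^ t) (+-monoˡ-≤ (x * R) qR≤xd) ⟩
  (x * d + x * R) * x ^ t        ≡⟨ collect x d R (x ^ t) ⟩
  (d + R) * (x * x ^ t)          ∎
  where
  open ≤-Reasoning
  expand : ∀ q x R y → (q + x) * (R * y) ≡ (q * R + x * R) * y
  expand = solve-∀
  collect : ∀ x d R y → (x * d + x * R) * y ≡ (d + R) * (x * y)
  collect = solve-∀
  qR≤xd : q * R ≤ x * d
  qR≤xd = +-cancelˡ-≤ (q * d) _ _
    (subst₂ _≤_ (*-distribˡ-+ q d R) (*-distribʳ-+ d q x) head)

-- At a heavy index, q · T_i ≤ (q + x) · d_i says T_{i+1} ≤ x / (q + x) · T_i.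
geometric-growth : ∀ {k} q x (d : Fin k → ℕ) →
  (∀ (i : Fin k) → suc (toℕ i) < k → 1 ≤ d i → q * tailSum d i ≤ (q + x) * d i) →
  ∀ t → wt (λ j → 1 ≤ᵇ d j) ≡ suc t → (q + x) ^ t ≤ sum d * x ^ t
geometric-growth {zero} q x d heavy t ()
geometric-growth {suc k} q x d heavy t count with d zero | heavy zero
... | zero | _ = geometric-growth q x (d ∘ suc) (λ i i<k → heavy (suc i) (s≤s i<k)) t count
... | suc e | heavy-head with t
...   | zero = s≤s z≤n
...   | suc t' = geometric-step q x (suc e) (sum (d ∘ suc)) t'
          (heavy-head (s≤s (<-≤-trans (s≤s z≤n) k≥count)) (s≤s z≤n))
          (geometric-growth q x (d ∘ suc) (λ i i<k → heavy (suc i) (s≤s i<k)) t' tail-count)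
  where
  tail-count : wt (λ j → 1 ≤ᵇ d (suc j)) ≡ suc t'
  tail-count = suc-injective count
  k≥count : suc t' ≤ k
  k≥count = subst (_≤ k) tail-count (wt≤length _)

unitVec : ∀ {k} → Fin k → F2Vec k
unitVec zero zero = true
unitVec zero (suc _) = false
unitVec (suc _) zero = false
unitVec (suc i) (suc j) = unitVec i j

xorFin-false : ∀ {k} → xorFin {k} (λ _ → false) ≡ false
xorFin-false {zero} = refl
xorFin-false {suc k} = xorFin-false {k}

lincomb-unitVec : ∀ {k n} i (M : F2Mat k n) c → lincomb (unitVec i) M c ≡ M i c
lincomb-unitVec {suc k} zero M c rewrite xorFin-false {k} = xor-identityʳ (M zero c)
lincomb-unitVec (suc i) M c = lincomb-unitVec i (M ∘ suc) c

module _ {k n} (B : F2Mat k n) where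

  epi-true : ∀ {j c} → epi B j c ≡ true → inPrefixSupp B j c ≡ false × B j c ≡ true
  epi-true {j} {c} bⱼ⁺ with inPrefixSupp B j c
  ... | false = refl , bⱼ⁺

  inPrefixSupp-intro : ∀ {j j' c} → toℕ j < toℕ j' → B j c ≡ true → inPrefixSupp B j' c ≡ true
  inPrefixSupp-intro {j} j<j' bⱼ = anyFin-intro _ j (cong₂ _∧_ (≤⇒≤ᵇ≡true j<j') bⱼ)

  inPrefixSupp-mono : ∀ {i j c} → toℕ i ≤ toℕ j →
    inPrefixSupp B i c ≡ true → inPrefixSupp B j c ≡ true
  inPrefixSupp-mono {i} {j} {c} i≤j inᵢ
    with j' , hit ← anyFin-elim (λ j' → (suc (toℕ j') ≤ᵇ toℕ i) ∧ B j' c) inᵢ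
    with j'<i , bⱼ' ← ∧-true {suc (toℕ j') ≤ᵇ toℕ i} hit =
    inPrefixSupp-intro {j'} {j} (≤-trans (≤ᵇ≡true⇒≤ j'<i) i≤j) bⱼ'

  epi-later≡false : ∀ {j j' c} → toℕ j < toℕ j' → B j c ≡ true → epi B j' c ≡ false
  epi-later≡false {j' = j'} {c} j<j' bⱼ rewrite inPrefixSupp-intro {j' = j'} {c} j<j' bⱼ = refl

  epi-disjoint : ∀ c j j' → epi B j c ≡ true → epi B j' c ≡ true → j ≡ j'
  epi-disjoint c j j' bⱼ⁺ bⱼ'⁺ with <-cmp (toℕ j) (toℕ j')
  ... | tri≈ _ j≡j' _ = toℕ-injective j≡j'
  ... | tri< j<j' _ _ =
    contradiction (trans (sym bⱼ'⁺) (epi-later≡false j<j' (proj₂ (epi-true bⱼ⁺)))) λ ()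
  ... | tri> _ _ j'<j =
    contradiction (trans (sym bⱼ⁺) (epi-later≡false j'<j (proj₂ (epi-true bⱼ'⁺)))) λ ()

  epi⊆supp-block : ∀ {i j c} → toℕ i ≤ toℕ j →
    epi B j c ≡ true → supp (block B i) c ≡ true
  epi⊆supp-block {i} {j} {c} i≤j bⱼ⁺ = anyFin-intro _ j block-entry
    where
    outside-prefix : inPrefixSupp B i c ≡ false
    outside-prefix with inPrefixSupp B i c in inᵢ
    ... | false = refl
    ... | true = contradiction
            (trans (sym (inPrefixSupp-mono i≤j inᵢ)) (proj₁ (epi-true bⱼ⁺))) λ ()
    block-entry : block B i j c ≡ true
    block-entry rewrite ≤⇒≤ᵇ≡true i≤j | outside-prefix = proj₂ (epi-true bⱼ⁺)

  tailSum-wt-epi≤wt-supp-block : ∀ i → tailSum (wt ∘ epi B) i ≤ wt (supp (block B i))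
  tailSum-wt-epi≤wt-supp-block i = begin
    tailSum (wt ∘ epi B) i                                   ≡⟨ tailSum≡sum-if-≤ (wt ∘ epi B) i ⟩
    sum (λ j → if toℕ i ≤ᵇ toℕ j then wt (epi B j) else 0)  ≡⟨ sum-cong-≗ (λ j → wt-∧ _ (epi B j)) ⟨
    sum (λ j → wt (λ c → (toℕ i ≤ᵇ toℕ j) ∧ epi B j c))     ≤⟨ disjoint-wt-sum≤wt _ _ disjoint late⊆supp ⟩
    wt (supp (block B i))                                    ∎
    where
    open ≤-Reasoning
    disjoint : ∀ c j j' → (toℕ i ≤ᵇ toℕ j) ∧ epi B j c ≡ true →
      (toℕ i ≤ᵇ toℕ j') ∧ epi B j' c ≡ true → j ≡ j'
    disjoint c j j' hit hit' =
      epi-disjoint c j j' (proj₂ (∧-true {toℕ i ≤ᵇ toℕ j} hit)) (proj₂ (∧-true {toℕ i ≤ᵇ toℕ j'} hit'))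
    late⊆supp : ∀ j c → (toℕ i ≤ᵇ toℕ j) ∧ epi B j c ≡ true → supp (block B i) c ≡ true
    late⊆supp j c hit with i≤j , bⱼ⁺ ← ∧-true {toℕ i ≤ᵇ toℕ j} hit =
      epi⊆supp-block {i} (≤ᵇ≡true⇒≤ i≤j) bⱼ⁺

  sum-wt-epi≤length : sum (wt ∘ epi B) ≤ n
  sum-wt-epi≤length = ≤-trans (disjoint-wt-sum≤wt (epi B) (λ _ → true) epi-disjoint (λ _ _ _ → refl))
    (wt≤length {n} (λ _ → true))

  block-diagonal : ∀ i c → block B i i c ≡ epi B i c
  block-diagonal i c rewrite ≤⇒≤ᵇ≡true (≤-refl {toℕ i}) = refl

DminBound : ∀ {k n} → F2Mat k n → Set
DminBound {k} B = ∀ (i : Fin k) → suc (toℕ i) < k → (a : F2Vec k) →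
  ¬ IsZero (lincomb a (block B i)) →
  2 ^ (wt (supp (block B i)) ∸ (k ∸ toℕ i)) ≤ (k ∸ toℕ i) ^ (10 * wt (lincomb a (block B i)))

excess : ∀ {k n} → F2Mat k n → Fin k → ℕ
excess B j = wt (epi B j) ∸ 1

module _ {k n} (B : F2Mat k n) (proper : Proper B) where

  wt-epi-positive : ∀ j → 1 ≤ wt (epi B j)
  wt-epi-positive j with wt (epi B j) in wtⱼ
  ... | zero = contradiction (wt≡0⇒IsZero (epi B j) wtⱼ) (proper j)
  ... | suc _ = s≤s z≤n

  sum-excess≤n∸k : sum (excess B) ≤ n ∸ k
  sum-excess≤n∸k = m+n≤o⇒m≤o∸n _
    (subst (_≤ n) (sum-∸1 (wt ∘ epi B) wt-epi-positive) (sum-wt-epi≤length B))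

  tailSum-excess-bound : DminBound B → ∀ i → suc (toℕ i) < k →
    2 ^ tailSum (excess B) i ≤ k ^ (10 * wt (epi B i))
  tailSum-excess-bound dmin i i<k = begin
    2 ^ tailSum (excess B) i                      ≤⟨ ^-monoʳ-≤ 2 tail≤n'∸k' ⟩
    2 ^ (wt (supp (block B i)) ∸ k')              ≤⟨ dmin i i<k (unitVec i) codeword≢0 ⟩
    k' ^ (10 * wt (lincomb (unitVec i) (block B i)))
      ≡⟨ cong (λ w → k' ^ (10 * w)) (wt-cong codeword≡bᵢ⁺) ⟩
    k' ^ (10 * wt (epi B i))                      ≤⟨ ^-monoˡ-≤ (10 * wt (epi B i)) (m∸n≤m k (toℕ i)) ⟩
    k ^ (10 * wt (epi B i))                       ∎
    where
    open ≤-Reasoning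
    k' = k ∸ toℕ i
    codeword≡bᵢ⁺ : ∀ c → lincomb (unitVec i) (block B i) c ≡ epi B i c
    codeword≡bᵢ⁺ c = trans (lincomb-unitVec i (block B i) c) (block-diagonal B i c)
    codeword≢0 : ¬ IsZero (lincomb (unitVec i) (block B i))
    codeword≢0 isZero = proper i (λ c → trans (sym (codeword≡bᵢ⁺ c)) (isZero c))
    tail≤n'∸k' : tailSum (excess B) i ≤ wt (supp (block B i)) ∸ k'
    tail≤n'∸k' = m+n≤o⇒m≤o∸n _ (subst (_≤ wt (supp (block B i)))
      (tailSum-∸1 (wt ∘ epi B) wt-epi-positive i) (tailSum-wt-epi≤wt-supp-block B i))

  heavy-index-bound : DminBound B → ∀ p q → k ^ q ≤ 2 ^ p →
    ∀ i → suc (toℕ i) < k → 1 ≤ excess B i → q * tailSum (excess B) i ≤ 20 * p * excess B i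
  heavy-index-bound dmin p q kᵠ≤2ᵖ i i<k heavy = begin
    q * tailSum (excess B) i   ≡⟨ *-comm q _ ⟩
    tailSum (excess B) i * q
      ≤⟨ ^-log-compare k (tailSum (excess B) i) _ p q (tailSum-excess-bound dmin i i<k) kᵠ≤2ᵖ ⟩
    p * (10 * wt (epi B i))    ≤⟨ 10w≤20[w∸1] p (wt (epi B i)) heavy ⟩
    20 * p * excess B i        ∎
    where open ≤-Reasoning

  heavy-growth : DminBound B → ∀ p q → k ^ q ≤ 2 ^ p → q ≤ 20 * p →
    ∀ t → numHeavyEpi B ≡ suc t → (20 * p) ^ t ≤ (n ∸ k) * (20 * p ∸ q) ^ t
  heavy-growth dmin p q kᵠ≤2ᵖ q≤20p t count = begin
    (20 * p) ^ t             ≡⟨ cong (_^ t) q+x≡20p ⟨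
    (q + x) ^ t              ≤⟨ geometric-growth q x (excess B) heavy-bound t excess-count ⟩
    sum (excess B) * x ^ t   ≤⟨ *-monoˡ-≤ (x ^ t) sum-excess≤n∸k ⟩
    (n ∸ k) * x ^ t          ∎
    where
    open ≤-Reasoning
    x = 20 * p ∸ q
    q+x≡20p : q + x ≡ 20 * p
    q+x≡20p = m+[n∸m]≡n q≤20p
    heavy-bound : ∀ i → suc (toℕ i) < k → 1 ≤ excess B i →
      q * tailSum (excess B) i ≤ (q + x) * excess B i
    heavy-bound i i<k heavy = subst (λ M → q * tailSum (excess B) i ≤ M * excess B i) (sym q+x≡20p)
      (heavy-index-bound dmin p q kᵠ≤2ᵖ i i<k heavy)
    excess-count : wt (λ j → 1 ≤ᵇ excess B j) ≡ suc t
    excess-count = trans (wt-cong (λ j → sym (2≤ᵇ≡1≤ᵇ∸1 (wt (epi B j))))) count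

mainTheorem10 : (k n : ℕ) → 2 ≤ k → k ≤ n → n < k ^ 5 →
    (B : F2Mat k n) → LinIndep B → Proper B →
    (∀ (i : Fin k) → suc (toℕ i) < k → (a : F2Vec k) →
      ¬ IsZero (lincomb a (block B i)) →
      2 ^ (wt (supp (block B i)) ∸ (k ∸ toℕ i))
        ≤ (k ∸ toℕ i) ^ (10 * wt (lincomb a (block B i)))) →
    (p q u v : ℕ) → 1 ≤ q → 1 ≤ v → k ^ q < 2 ^ p → (n ∸ k) ^ v < 2 ^ u →
    (numHeavyEpi B ∸ 1) * q * v ≤ 20 * p * u
mainTheorem10 k n 2≤k _ _ B _ proper dmin p q u v _ _ kᵠ<2ᵖ [n∸k]ᵛ<2ᵘ with numHeavyEpi B in count
... | zero = z≤n
... | suc t = log-ratio-bound x (20 * p) (n ∸ k) t q u v 1≤x bernoulli-bound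
  (heavy-growth B proper dmin p q (<⇒≤ kᵠ<2ᵖ) (<⇒≤ q<20p) t count) (<⇒≤ [n∸k]ᵛ<2ᵘ)
  where
  q<20p : q < 20 * p
  q<20p = <-≤-trans (^-cancelʳ-< 2 (s≤s (s≤s z≤n)) (≤-<-trans (^-monoˡ-≤ q 2≤k) kᵠ<2ᵖ)) (m≤n*m p 20)
  x = 20 * p ∸ q
  1≤x : 1 ≤ x
  1≤x = m+n≤o⇒m≤o∸n 1 q<20p
  bernoulli-bound : 2 ^ q * x ^ (20 * p) ≤ (20 * p) ^ (20 * p)
  bernoulli-bound = subst (λ M → 2 ^ q * x ^ M ≤ M ^ M) (trans (+-comm x q) (m+[n∸m]≡n (<⇒≤ q<20p)))
    (2^q*x^[x+q]≤[x+q]^[x+q] q x)
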